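{- For every integer $k\ge3$ and all positive integers $n_1,\ldots,n_k$, neither the graph $H_{1,2n_1,\ldots,2n_k}$ nor its complement $\overline{H_{1,2n_1,\ldots,2n_k}}$ is a comparability graph.
   Context: A comparability graph is a graph admitting a transitive orientation (a transitive digraph obtained by orienting each edge in exactly one direction). The complement $\overline{G}$ of $G$ has the same vertices and the non-edges of $G$ as edges. For $n\ge0$, $t_n(p)=p+n$ and $t_n(G)$ is the copy of $G$ with vertices shifted by $n$. Put $s_0=0$, $s_i=n_1+\cdots+n_i$. - $G_{2n}$: graph on $\{0,\ldots,2n-1\}$ with edges $\{2i,2j+1\}$, $0\le i\le j\le n-1$. - $G'_{2n}$: graph on $\{0,\ldots,2n-1\}$ with edges $E(G_{2n})\cup\{\{2p-1,2q-1\}:1\le p<q\le n\}$. - $H_{1,2n_1,\ldots,2n_k}$: graph on $\{0,\ldots,2s_k\}$ with edge set $\bigcup_{i=0}^{k-1}E(t_{2s_i+1}(G'_{2n_{i+1}}))\cup\{\{2p,2q\}:0\le p<q\le s_k\}$. -}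

module Defs where

open import Data.Nat using (ℕ; zero; suc; _+_; _*_; _≤_; _<_)
open import Data.Fin using (Fin; toℕ)
open import Data.List using (List; length; lookup; take)
open import Data.Nat.ListAction using (sum)
open import Data.Product using (Σ; ∃; ∃-syntax; _×_; _,_)
open import Data.Sum using (_⊎_)
open import Relation.Binary.PropositionalEquality using (_≡_; _≢_)
open import Relation.Nullary using (¬_)

record Graph : Set₁ where
  field
    N   : ℕ
    Adj : Fin N → Fin N → Set
open Graph public

complement : Graph → Graph
complement G = record { N = N G ; Adj = λ x y → x ≢ y × ¬ Adj G x y }

record IsTransitiveOrientation (G : Graph) (D : Fin (N G) → Fin (N G) → Set) : Set where
  field
    arc⇒edge   : ∀ x y → D x y → Adj G x y
    edge⇒arc   : ∀ x y → Adj G x y → D x y ⊎ D y x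
    antisym    : ∀ x y → D x y → ¬ D y x
    transitive : ∀ x y z → D x y → D y z → D x z

IsComparabilityGraph : Graph → Set₁
IsComparabilityGraph G = ∃[ D ] IsTransitiveOrientation G D

Sym : (ℕ → ℕ → Set) → ℕ → ℕ → Set
Sym R x y = R x y ⊎ R y x

GE : ℕ → ℕ → ℕ → Set
GE n x y = ∃[ i ] ∃[ j ] (i ≤ j × j < n × x ≡ 2 * i × y ≡ 2 * j + 1)

-- Edges of G'_{2n}: E(G_{2n}) ∪ {{2p-1, 2q-1} : 1 ≤ p < q ≤ n}
-- (written with p = p'+1, q = q'+1, so 2p-1 = 2p'+1).
G'E : ℕ → ℕ → ℕ → Set
G'E n x y = GE n x y
          ⊎ (∃[ p ] ∃[ q ] (p < q × q < n × x ≡ 2 * p + 1 × y ≡ 2 * q + 1))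

s : List ℕ → ℕ → ℕ
s ns i = sum (take i ns)

-- Edges of H_{1,2n_1,…,2n_k} (ns = [n_1,…,n_k]), as a relation on ℕ:
-- shifted copies t_{2s_i+1}(G'_{2n_{i+1}}) for i = 0..k-1, plus {2p,2q}, 0 ≤ p < q ≤ s_k.
HE : List ℕ → ℕ → ℕ → Set
HE ns x y =
  (Σ (Fin (length ns)) λ i → ∃[ a ] ∃[ b ]
      (Sym (G'E (lookup ns i)) a b
       × x ≡ 2 * s ns (toℕ i) + 1 + a
       × y ≡ 2 * s ns (toℕ i) + 1 + b))
  ⊎ (∃[ p ] ∃[ q ] (p < q × q ≤ s ns (length ns) × Sym (λ u v → u ≡ 2 * p × v ≡ 2 * q) x y))

H : List ℕ → Graph
H ns = record { N = 2 * s ns (length ns) + 1 ; Adj = λ x y → HE ns (toℕ x) (toℕ y) }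

{-# OPTIONS --safe #-}
-- In each of three blocks take the last odd vertex 2s_{i+1} - 1 and the even vertex
-- 2s_{i+1} after it. The even vertices form a triangle and each odd one is adjacent
-- to its own even partner only, so the six vertices induce a net, and in the
-- complement a 3-sun. Neither admits a transitive orientation: by Gallai's forcing,
-- a pendant edge of the net orients both triangle edges at its foot the same way, and
-- two of the three pendants point the same way; in the 3-sun a directed path of
-- length two in the central triangle forces an arc between two non-adjacent
-- outer vertices.
module Submission where

open import Defs
open import Data.Nat using (ℕ; zero; suc; pred; _+_; _*_; _≤_; _<_; z≤n; s≤s; s≤s⁻¹; >-nonZero)
open import Data.Nat.Properties
open import Data.Nat.Tactic.RingSolver using (solve-∀)
open import Data.Fin using (Fin; toℕ; fromℕ<; inject≤)
import Data.Fin as Fin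
open import Data.Fin.Patterns using (0F; 1F; 2F)
open import Data.Fin.Properties using (toℕ-fromℕ<; toℕ<n; toℕ-injective; inject≤-injective)
open import Data.List using (List; []; _∷_; length; lookup)
open import Data.List.Membership.Propositional.Properties using (∈-lookup)
open import Data.List.Relation.Unary.All as All using (All; _∷_)
open import Data.Product using (Σ; ∃-syntax; _×_; _,_)
open import Data.Sum using (_⊎_; inj₁; inj₂; swap)
open import Data.Empty using (⊥; ⊥-elim)
open import Function using (_∘_; flip)
open import Relation.Nullary using (¬_; contradiction)
open import Relation.Binary.Definitions using (Symmetric; tri<; tri≈; tri>)
open import Relation.Binary.PropositionalEquality

complement-symmetric : ∀ {G} → Symmetric (Adj G) → Symmetric (Adj (complement G))
complement-symmetric adj-sym (x≢y , ¬xy) = x≢y ∘ sym , ¬xy ∘ adj-sym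

reverse : ∀ {G D} → Symmetric (Adj G) →
          IsTransitiveOrientation G D → IsTransitiveOrientation G (flip D)
reverse adj-sym T = record
  { arc⇒edge   = λ x y → adj-sym ∘ arc⇒edge y x
  ; edge⇒arc   = λ x y → swap ∘ edge⇒arc x y
  ; antisym    = λ x y → antisym y x
  ; transitive = λ x y z x←y y←z → transitive z y x y←z x←y
  }
  where open IsTransitiveOrientation T

module _ {G : Graph} {D : Fin (N G) → Fin (N G) → Set} (T : IsTransitiveOrientation G D) where
  open IsTransitiveOrientation T

  forces-inward : ∀ {x y z} → Adj G y z → ¬ Adj G x z → D x y → D z y
  forces-inward {x} {y} {z} yz ¬xz x→y with edge⇒arc y z yz
  ... | inj₁ y→z = contradiction (arc⇒edge x z (transitive x y z x→y y→z)) ¬xz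
  ... | inj₂ z→y = z→y

forces-outward : ∀ {G D} → Symmetric (Adj G) → IsTransitiveOrientation G D →
                 ∀ {x y z} → Adj G y z → ¬ Adj G x z → D y x → D y z
forces-outward adj-sym T = forces-inward (reverse adj-sym T)

two-of-three-agree : (P Q : Fin 3 → Set) → (∀ i → P i ⊎ Q i) →
                     (∀ {i j} → i ≢ j → P i → P j → ⊥) →
                     (∀ {i j} → i ≢ j → Q i → Q j → ⊥) → ⊥
two-of-three-agree P Q side noP noQ with side 0F | side 1F | side 2F
... | inj₁ p₀ | inj₁ p₁ | _       = noP (λ ()) p₀ p₁
... | inj₂ q₀ | inj₂ q₁ | _       = noQ (λ ()) q₀ q₁
... | inj₁ p₀ | inj₂ _  | inj₁ p₂ = noP (λ ()) p₀ p₂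
... | inj₁ _  | inj₂ q₁ | inj₂ q₂ = noQ (λ ()) q₁ q₂
... | inj₂ q₀ | inj₁ _  | inj₂ q₂ = noQ (λ ()) q₀ q₂
... | inj₂ _  | inj₁ p₁ | inj₁ p₂ = noP (λ ()) p₁ p₂

tournament₃-path₂ : (R : Fin 3 → Fin 3 → Set) → (∀ {i j} → i ≢ j → R i j ⊎ R j i) →
                    (∀ {i j k} → i ≢ j → j ≢ k → i ≢ k → R i j → R j k → ⊥) → ⊥
tournament₃-path₂ R orient noPath
  with orient {0F} {1F} (λ ()) | orient {1F} {2F} (λ ()) | orient {0F} {2F} (λ ())
... | inj₁ r₀₁ | inj₁ r₁₂ | _        = noPath (λ ()) (λ ()) (λ ()) r₀₁ r₁₂
... | inj₁ r₀₁ | inj₂ r₂₁ | inj₁ r₀₂ = noPath (λ ()) (λ ()) (λ ()) r₀₂ r₂₁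
... | inj₁ r₀₁ | inj₂ r₂₁ | inj₂ r₂₀ = noPath (λ ()) (λ ()) (λ ()) r₂₀ r₀₁
... | inj₂ r₁₀ | inj₁ r₁₂ | inj₁ r₀₂ = noPath (λ ()) (λ ()) (λ ()) r₁₀ r₀₂
... | inj₂ r₁₀ | inj₁ r₁₂ | inj₂ r₂₀ = noPath (λ ()) (λ ()) (λ ()) r₁₂ r₂₀
... | inj₂ r₁₀ | inj₂ r₂₁ | _        = noPath (λ ()) (λ ()) (λ ()) r₂₁ r₁₀

record InducedNet (G : Graph) (a b : Fin 3 → Fin (N G)) : Set where
  field
    spoke       : ∀ i → Adj G (a i) (b i)
    triangle    : ∀ {i j} → i ≢ j → Adj G (b i) (b j)
    nonSpoke    : ∀ {i j} → i ≢ j → ¬ Adj G (a i) (b j)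
    independent : ∀ {i j} → i ≢ j → ¬ Adj G (a i) (a j)

record InducedSun (G : Graph) (a b : Fin 3 → Fin (N G)) : Set where
  field
    triangle    : ∀ {i j} → i ≢ j → Adj G (a i) (a j)
    ray         : ∀ {i j} → i ≢ j → Adj G (b i) (a j)
    nonRay      : ∀ i → ¬ Adj G (b i) (a i)
    independent : ∀ {i j} → i ≢ j → ¬ Adj G (b i) (b j)

net-incomparable : ∀ {G a b} → Symmetric (Adj G) → InducedNet G a b → ¬ IsComparabilityGraph G
net-incomparable {G} {a} {b} adj-sym net (D , T) =
  two-of-three-agree (λ i → D (a i) (b i)) (λ i → D (b i) (a i))
    (λ i → edge⇒arc (a i) (b i) (spoke i)) two-inward two-outward
  where
  open InducedNet net
  open IsTransitiveOrientation T

  two-inward : ∀ {i j} → i ≢ j → D (a i) (b i) → D (a j) (b j) → ⊥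
  two-inward i≢j aᵢ→bᵢ aⱼ→bⱼ = antisym _ _
    (forces-inward T (triangle i≢j) (nonSpoke i≢j) aᵢ→bᵢ)
    (forces-inward T (triangle (i≢j ∘ sym)) (nonSpoke (i≢j ∘ sym)) aⱼ→bⱼ)

  two-outward : ∀ {i j} → i ≢ j → D (b i) (a i) → D (b j) (a j) → ⊥
  two-outward i≢j bᵢ→aᵢ bⱼ→aⱼ = antisym _ _
    (forces-outward adj-sym T (triangle i≢j) (nonSpoke i≢j) bᵢ→aᵢ)
    (forces-outward adj-sym T (triangle (i≢j ∘ sym)) (nonSpoke (i≢j ∘ sym)) bⱼ→aⱼ)

sun-incomparable : ∀ {G a b} → Symmetric (Adj G) → InducedSun G a b → ¬ IsComparabilityGraph G
sun-incomparable {G} {a} {b} adj-sym sun (D , T) =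
  tournament₃-path₂ (λ i j → D (a i) (a j)) (λ i≢j → edge⇒arc _ _ (triangle i≢j)) no-path
  where
  open InducedSun sun
  open IsTransitiveOrientation T

  no-path : ∀ {i j k} → i ≢ j → j ≢ k → i ≢ k → D (a i) (a j) → D (a j) (a k) → ⊥
  no-path {i} {j} {k} i≢j j≢k i≢k aᵢ→aⱼ aⱼ→aₖ =
    independent i≢k (arc⇒edge _ _ (transitive _ _ _ bᵢ→aⱼ aⱼ→bₖ))
    where
    bᵢ→aⱼ : D (b i) (a j)
    bᵢ→aⱼ = forces-inward T (adj-sym (ray i≢j)) (nonRay i ∘ adj-sym) aᵢ→aⱼ
    aⱼ→bₖ : D (a j) (b k)
    aⱼ→bₖ = forces-outward adj-sym T (adj-sym (ray (j≢k ∘ sym))) (nonRay k ∘ adj-sym) aⱼ→aₖ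

net-complement-sun : ∀ {G a b} → Symmetric (Adj G) → InducedNet G a b →
                     InducedSun (complement G) a b
net-complement-sun {G} {a} {b} adj-sym net = record
  { triangle    = λ i≢j → leaves-distinct i≢j , independent i≢j
  ; ray         = λ i≢j → corner≢leaf i≢j , nonSpoke (i≢j ∘ sym) ∘ adj-sym
  ; nonRay      = λ i (_ , ¬bᵢaᵢ) → ¬bᵢaᵢ (adj-sym (spoke i))
  ; independent = λ i≢j (_ , ¬bᵢbⱼ) → ¬bᵢbⱼ (triangle i≢j)
  }
  where
  open InducedNet net

  leaves-distinct : ∀ {i j} → i ≢ j → a i ≢ a j
  leaves-distinct {i} i≢j aᵢ≡aⱼ =
    nonSpoke (i≢j ∘ sym) (subst (λ v → Adj G v (b i)) aᵢ≡aⱼ (spoke i))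

  corner≢leaf : ∀ {i j} → i ≢ j → b i ≢ a j
  corner≢leaf {i} i≢j bᵢ≡aⱼ = independent i≢j (subst (Adj G (a i)) bᵢ≡aⱼ (spoke i))

complement-incomparable : ∀ {G a b} → Symmetric (Adj G) → InducedNet G a b →
                          ¬ IsComparabilityGraph (complement G)
complement-incomparable adj-sym net =
  sun-incomparable (complement-symmetric adj-sym) (net-complement-sun adj-sym net)

odd≢even : ∀ m n → 2 * m + 1 ≢ 2 * n
odd≢even m n eq = even≢odd n m (trans (sym eq) (+-comm (2 * m) 1))

odd-injective : ∀ {m n} → 2 * m + 1 ≡ 2 * n + 1 → m ≡ n
odd-injective {m} {n} eq = *-cancelˡ-≡ m n 2 (+-cancelʳ-≡ 1 (2 * m) (2 * n) eq)

odd<even : ∀ {m n} → m < n → 2 * m + 1 < 2 * n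
odd<even {m} {n} m<n = subst (_≤ 2 * n) (double-suc m) (*-monoʳ-≤ 2 m<n)
  where
  double-suc : ∀ m → 2 * suc m ≡ suc (2 * m + 1)
  double-suc = solve-∀

shift-even : ∀ S i → 2 * S + 1 + 2 * i ≡ 2 * (S + i) + 1
shift-even = solve-∀

shift-odd : ∀ S j → 2 * S + 1 + (2 * j + 1) ≡ 2 * (S + suc j)
shift-odd = solve-∀

s-suc : ∀ ns (l : Fin (length ns)) → s ns (suc (toℕ l)) ≡ s ns (toℕ l) + lookup ns l
s-suc (x ∷ xs) Fin.zero    = +-identityʳ x
s-suc (x ∷ xs) (Fin.suc l) = trans (cong (x +_) (s-suc xs l)) (sym (+-assoc x _ _))

s-mono : ∀ ns {i j} → i ≤ j → s ns i ≤ s ns j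
s-mono []       {zero}  {zero}  _         = z≤n
s-mono []       {zero}  {suc j} _         = z≤n
s-mono []       {suc i} {suc j} _         = z≤n
s-mono (x ∷ xs) {zero}           _         = z≤n
s-mono (x ∷ xs) {suc i} {suc j} (s≤s i≤j) = +-monoʳ-≤ x (s-mono xs i≤j)

s-cancel-< : ∀ ns {i j} → s ns i < s ns j → i < j
s-cancel-< ns {i} {j} sᵢ<sⱼ = ≰⇒> (λ j≤i → <⇒≱ sᵢ<sⱼ (s-mono ns j≤i))

s-strictMono : ∀ {ns} → All (0 <_) ns → ∀ {i j} → i < j → j ≤ length ns → s ns i < s ns j
s-strictMono {x ∷ xs} (x>0 ∷ _)   {zero}  {suc j} _         _           = <-≤-trans x>0 (m≤m+n x _)
s-strictMono {x ∷ xs} (_   ∷ pos) {suc i} {suc j} (s≤s i<j) (s≤s j≤len) =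
  +-monoʳ-< x (s-strictMono pos i<j j≤len)

HE-sym : ∀ ns {u w} → HE ns u w → HE ns w u
HE-sym ns (inj₁ (l , a , b , ab , eu , ew)) = inj₁ (l , b , a , swap ab , ew , eu)
HE-sym ns (inj₂ (p , q , p<q , q≤sₖ , e))   = inj₂ (p , q , p<q , q≤sₖ , swap e)

-- Block vertex 2S+1+a is odd only for a even, and even local vertices 2i are adjacent
-- only to the odd local vertices 2j+1 with i ≤ j.
block-odd-neighbour : ∀ {n S A a b} → Sym (G'E n) a b → 2 * S + 1 + a ≡ 2 * A + 1 →
                      ∃[ B ] (2 * S + 1 + b ≡ 2 * B × S ≤ A × A < B × B ≤ S + n)
block-odd-neighbour {S = S} {A} (inj₁ (inj₁ (i , j , i≤j , j<n , refl , refl))) eq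
  with odd-injective {S + i} {A} (trans (sym (shift-even S i)) eq)
... | refl = S + suc j , shift-odd S j , m≤m+n S i , +-monoʳ-< S (s≤s i≤j) , +-monoʳ-≤ S j<n
block-odd-neighbour {S = S} {A} (inj₁ (inj₂ (p , _ , _ , _ , refl , refl))) eq =
  ⊥-elim (odd≢even A (S + suc p) (trans (sym eq) (shift-odd S p)))
block-odd-neighbour {S = S} {A} (inj₂ (inj₁ (_ , j , _ , _ , refl , refl))) eq =
  ⊥-elim (odd≢even A (S + suc j) (trans (sym eq) (shift-odd S j)))
block-odd-neighbour {S = S} {A} (inj₂ (inj₂ (_ , q , _ , _ , refl , refl))) eq =
  ⊥-elim (odd≢even A (S + suc q) (trans (sym eq) (shift-odd S q)))

HE-odd-neighbour : ∀ ns {A w} → HE ns (2 * A + 1) w →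
                   Σ (Fin (length ns)) λ l → ∃[ B ]
                     (w ≡ 2 * B × s ns (toℕ l) ≤ A × A < B × B ≤ s ns (suc (toℕ l)))
HE-odd-neighbour ns (inj₁ (l , a , b , ab , eA , refl))
  with block-odd-neighbour ab (sym eA)
... | B , e , S≤A , A<B , B≤S+n = l , B , e , S≤A , A<B , ≤-trans B≤S+n (≤-reflexive (sym (s-suc ns l)))
HE-odd-neighbour ns {A} (inj₂ (p , _ , _ , _ , inj₁ (e , _))) = ⊥-elim (odd≢even A p e)
HE-odd-neighbour ns {A} (inj₂ (_ , q , _ , _ , inj₂ (_ , e))) = ⊥-elim (odd≢even A q e)

HE-odd-independent : ∀ ns A A' → ¬ HE ns (2 * A + 1) (2 * A' + 1)
HE-odd-independent ns A A' h with HE-odd-neighbour ns {A} h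
... | _ , B , e , _ = odd≢even A' B e

blockEnd : (ns : List ℕ) → Fin (length ns) → ℕ
blockEnd ns l = s ns (suc (toℕ l))

lastOdd : (ns : List ℕ) → Fin (length ns) → ℕ
lastOdd ns l = s ns (toℕ l) + pred (lookup ns l)

blockEnd≤total : ∀ ns l → blockEnd ns l ≤ s ns (length ns)
blockEnd≤total ns l = s-mono ns (toℕ<n l)

module _ {ns : List ℕ} (pos : All (0 <_) ns) where

  suc-pred-lookup : ∀ l → suc (pred (lookup ns l)) ≡ lookup ns l
  suc-pred-lookup l = suc-pred (lookup ns l) {{>-nonZero (All.lookup pos (∈-lookup l))}}

  suc-lastOdd : ∀ l → suc (lastOdd ns l) ≡ blockEnd ns l
  suc-lastOdd l = begin
    suc (S + m)          ≡⟨ +-suc S m ⟨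
    S + suc m            ≡⟨ cong (S +_) (suc-pred-lookup l) ⟩
    S + lookup ns l      ≡⟨ s-suc ns l ⟨
    blockEnd ns l        ∎
    where
    open ≡-Reasoning
    S = s ns (toℕ l)
    m = pred (lookup ns l)

  blockEnd-strictMono : ∀ {l l'} → toℕ l < toℕ l' → blockEnd ns l < blockEnd ns l'
  blockEnd-strictMono {l' = l'} l<l' = s-strictMono pos (s≤s l<l') (toℕ<n l')

  spoke-HE : ∀ l → HE ns (2 * lastOdd ns l + 1) (2 * blockEnd ns l)
  spoke-HE l = inj₁ (l , 2 * m , 2 * m + 1 ,
                     inj₁ (inj₁ (m , m , ≤-refl , ≤-reflexive (suc-pred-lookup l) , refl , refl)) ,
                     sym (shift-even S m) , even-end)
    where
    S = s ns (toℕ l)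
    m = pred (lookup ns l)
    even-end : 2 * blockEnd ns l ≡ 2 * S + 1 + (2 * m + 1)
    even-end = sym (trans (shift-odd S m) (cong (2 *_) (trans (+-suc S m) (suc-lastOdd l))))

  triangle-HE : ∀ {l l'} → l ≢ l' → HE ns (2 * blockEnd ns l) (2 * blockEnd ns l')
  triangle-HE {l} {l'} l≢l' with <-cmp (toℕ l) (toℕ l')
  ... | tri< l<l' _ _ =
    inj₂ (_ , _ , blockEnd-strictMono l<l' , blockEnd≤total ns l' , inj₁ (refl , refl))
  ... | tri≈ _ l≡l' _ = ⊥-elim (l≢l' (toℕ-injective l≡l'))
  ... | tri> _ _ l'<l =
    inj₂ (_ , _ , blockEnd-strictMono l'<l , blockEnd≤total ns l , inj₂ (refl , refl))

  nonSpoke-HE : ∀ {l l'} → l ≢ l' → ¬ HE ns (2 * lastOdd ns l + 1) (2 * blockEnd ns l')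
  nonSpoke-HE {l} {l'} l≢l' h with HE-odd-neighbour ns h
  ... | m , B , e , sₘ≤A , A<B , B≤endₘ with *-cancelˡ-≡ (blockEnd ns l') B 2 e
  ... | refl with <-cmp (toℕ l) (toℕ l')
  ... | tri≈ _ l≡l' _ = l≢l' (toℕ-injective l≡l')
  ... | tri> _ _ l'<l =
    <-irrefl refl (<-≤-trans A<B (≤-trans (s-mono ns l'<l) (m≤m+n _ _)))
  ... | tri< l<l' _ _ = <-irrefl refl (begin-strict
    lastOdd ns l    <⟨ ≤-reflexive (suc-lastOdd l) ⟩
    blockEnd ns l   ≤⟨ s-mono ns l<m ⟩
    s ns (toℕ m)    ≤⟨ sₘ≤A ⟩
    lastOdd ns l    ∎)
    where
    open ≤-Reasoning
    l<m : suc (toℕ l) ≤ toℕ m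
    l<m = s≤s⁻¹ (s-cancel-< ns (<-≤-trans (blockEnd-strictMono l<l') B≤endₘ))

module _ {ns : List ℕ} {x y : Fin (N (H ns))} {u w : ℕ} (x≡u : toℕ x ≡ u) (y≡w : toℕ y ≡ w) where

  HE⇒Adj : HE ns u w → Adj (H ns) x y
  HE⇒Adj = subst₂ (HE ns) (sym x≡u) (sym y≡w)

  ¬HE⇒¬Adj : ¬ HE ns u w → ¬ Adj (H ns) x y
  ¬HE⇒¬Adj ¬h = ¬h ∘ subst₂ (HE ns) x≡u y≡w

H-net : ∀ ns → 3 ≤ length ns → All (0 <_) ns →
        Σ (Fin 3 → Fin (N (H ns))) λ a → Σ (Fin 3 → Fin (N (H ns))) λ b → InducedNet (H ns) a b
H-net ns 3≤k pos = leaf , corner , record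
  { spoke       = λ i → HE⇒Adj (toℕ-leaf i) (toℕ-corner i) (spoke-HE pos (block i))
  ; triangle    = λ {i} {j} i≢j → HE⇒Adj (toℕ-corner i) (toℕ-corner j)
                            (triangle-HE pos (block-injective i≢j))
  ; nonSpoke    = λ {i} {j} i≢j → ¬HE⇒¬Adj (toℕ-leaf i) (toℕ-corner j)
                            (nonSpoke-HE pos (block-injective i≢j))
  ; independent = λ {i} {j} _ → ¬HE⇒¬Adj (toℕ-leaf i) (toℕ-leaf j)
                                  (HE-odd-independent ns (lastOdd ns (block i)) (lastOdd ns (block j)))
  }
  where
  total = 2 * s ns (length ns)

  block : Fin 3 → Fin (length ns)
  block i = inject≤ i 3≤k

  block-injective : ∀ {i j} → i ≢ j → block i ≢ block j
  block-injective i≢j = i≢j ∘ inject≤-injective _ _ _ _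

  corner<N : ∀ l → 2 * blockEnd ns l < total + 1
  corner<N l = ≤-<-trans (*-monoʳ-≤ 2 (blockEnd≤total ns l)) (m<m+n total (s≤s z≤n))

  leaf<N : ∀ l → 2 * lastOdd ns l + 1 < total + 1
  leaf<N l = <-trans (odd<even (≤-reflexive (suc-lastOdd pos l))) (corner<N l)

  leaf corner : Fin 3 → Fin (N (H ns))
  leaf i   = fromℕ< (leaf<N (block i))
  corner i = fromℕ< (corner<N (block i))

  toℕ-leaf : ∀ i → toℕ (leaf i) ≡ 2 * lastOdd ns (block i) + 1
  toℕ-leaf i = toℕ-fromℕ< (leaf<N (block i))

  toℕ-corner : ∀ i → toℕ (corner i) ≡ 2 * blockEnd ns (block i)
  toℕ-corner i = toℕ-fromℕ< (corner<N (block i))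

mainTheorem5 : (ns : List ℕ) → 3 ≤ length ns → All (λ n → 0 < n) ns →
    ¬ IsComparabilityGraph (H ns) × ¬ IsComparabilityGraph (complement (H ns))
mainTheorem5 ns 3≤k pos with H-net ns 3≤k pos
... | _ , _ , net = net-incomparable (HE-sym ns) net , complement-incomparable (HE-sym ns) net
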